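{- Let $P_0=0$, $P_1=1$, $P_n=2P_{n-1}+P_{n-2}$ be the Pell sequence, and for an integer $m>1$ let $\pi_2(m)$ be the length of the shortest period of $(P_n)$ modulo $m$. Then an integer $m>1$ satisfies $\pi_2(m)=m$ if and only if $m=2^k$ for some integer $k\ge1$. -}

module Defs where

open import Data.Nat using (ℕ; zero; suc; _+_; _*_; _<_; _%_; NonZero)
open import Relation.Binary.PropositionalEquality using (_≡_)
open import Data.Product using (_×_)

P : ℕ → ℕ
P zero = 0
P (suc zero) = 1
P (suc (suc n)) = 2 * P (suc n) + P n

IsPeriodMod : (m : ℕ) .{{_ : NonZero m}} → ℕ → Set
IsPeriodMod m p = 0 < p × (∀ n → P (n + p) % m ≡ P n % m)

IsShortestPeriodMod : (m : ℕ) .{{_ : NonZero m}} → ℕ → Set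
IsShortestPeriodMod m p = IsPeriodMod m p × (∀ q → IsPeriodMod m q → p Data.Nat.≤ q)

{-# OPTIONS --safe #-}
module Submission where

-- Write Q n + P n √2 = (1 + √2) ^ n. Then T is a period of P modulo m exactly when
-- P T ≡ 0 and Q T ≡ 1 (mod m), and if T is a period modulo s then q T is one modulo q s
-- for every q ∣ s. Hence 2 ^ k is a period modulo 2 ^ k, and as P (2 ^ j) is divisible by
-- 2 ^ j but not by 2 ^ (j + 1), every period modulo 2 ^ k is a multiple of 2 ^ k.
-- For an odd prime q the binomial expansion gives P q ≡ 2 ^ ((q - 1) / 2) ≡ ±1 and Q q ≡ 1
-- (mod q), so q - 1 or 2 (q + 1) is a period modulo q. If the largest prime factor p of m is
-- odd, building a period of m along its prime factorisation from these (lifting at repeated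
-- primes, multiplying at new ones) yields a period whose p-adic valuation is smaller than that
-- of m; as the shortest period divides every period, it cannot be m.

open import Defs
open import Data.Nat using (ℕ; NonZero; _<_; _≤_; _^_)
open import Data.Product using (_×_; ∃-syntax; _,_; proj₁; proj₂)
open import Relation.Binary.PropositionalEquality
  using (_≡_; refl; sym; trans; cong; cong₂; subst; module ≡-Reasoning)
open import Function.Bundles using (_⇔_; mk⇔)

module Primes where

  open import Data.Nat using (zero; suc; _*_)
  import Data.Nat.Properties as ℕ
  open import Data.Nat.Divisibility
    using (_∣_; divides; 1∣_; ∣-trans; m∣m*n; *-monoʳ-∣; *-monoˡ-∣; *-cancelˡ-∣)
  open import Data.Nat.Primality
    using (Prime; prime⇒irreducible; irreducible[2]; ¬prime[1]; euclidsLemma; prime⇒nonZero)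
  open import Data.Nat.Coprimality using (Coprime; coprime-divisor)
  open import Data.Nat.Tactic.RingSolver using (solve-∀)
  open import Data.Sum using (_⊎_; inj₁; inj₂)
  open import Data.Empty using (⊥-elim)
  open import Relation.Nullary using (¬_)
  open import Relation.Binary.PropositionalEquality using (_≢_)

  even⊎odd : ∀ n → ∃[ r ] (n ≡ 2 * r ⊎ n ≡ suc (2 * r))
  even⊎odd zero = 0 , inj₁ refl
  even⊎odd (suc n) with even⊎odd n
  ... | r , inj₁ n≡2r = r , inj₂ (cong suc n≡2r)
  ... | r , inj₂ n≡1+2r = suc r , inj₁ (trans (cong suc n≡1+2r) (sym (ℕ.*-suc 2 r)))

  prime≢2⇒odd : ∀ {q} → Prime q → q ≢ 2 → ∃[ r ] q ≡ suc (2 * r)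
  prime≢2⇒odd {q} q-prime q≢2 with even⊎odd q
  ... | r , inj₂ q≡1+2r = r , q≡1+2r
  ... | r , inj₁ q≡2r with prime⇒irreducible q-prime (divides r (trans q≡2r (ℕ.*-comm 2 r)))
  ...   | inj₁ ()
  ...   | inj₂ 2≡q = ⊥-elim (q≢2 (sym 2≡q))

  prime≢2⇒∤2 : ∀ {q} → Prime q → q ≢ 2 → ¬ q ∣ 2
  prime≢2⇒∤2 q-prime q≢2 q∣2 with irreducible[2] q∣2
  ... | inj₁ refl = ¬prime[1] q-prime
  ... | inj₂ q≡2 = q≢2 q≡2

  prime^∣-cancelʳ : ∀ {p a b} j → Prime p → ¬ p ∣ b → p ^ j ∣ a * b → p ^ j ∣ a
  prime^∣-cancelʳ {p} {a} zero p-prime p∤b _ = 1∣ a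
  prime^∣-cancelʳ {p} {a} {b} (suc j) p-prime p∤b p^[1+j]∣ab
    with euclidsLemma a b p-prime (∣-trans (m∣m*n (p ^ j)) p^[1+j]∣ab)
  ... | inj₂ p∣b = ⊥-elim (p∤b p∣b)
  ... | inj₁ (divides c refl) =
    subst (p ^ suc j ∣_) (ℕ.*-comm p c) (*-monoʳ-∣ p (prime^∣-cancelʳ j p-prime p∤b p^j∣cb))
    where
      instance _ = prime⇒nonZero p-prime
      p^j∣cb : p ^ j ∣ c * b
      p^j∣cb = *-cancelˡ-∣ p (subst (p ^ suc j ∣_) (regroup c p b) p^[1+j]∣ab)
        where regroup : ∀ c p b → c * p * b ≡ p * (c * b)
              regroup = solve-∀

  coprime⇒*∣ : ∀ {m n c} → Coprime m n → m ∣ c → n ∣ c → m * n ∣ c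
  coprime⇒*∣ {m} {n} coprime m∣c (divides k refl) =
    *-monoˡ-∣ n (coprime-divisor coprime (subst (m ∣_) (ℕ.*-comm k n) m∣c))

  prime∤⇒coprime : ∀ {q s} → Prime q → ¬ q ∣ s → Coprime q s
  prime∤⇒coprime q-prime q∤s (i∣q , i∣s) with prime⇒irreducible q-prime i∣q
  ... | inj₁ i≡1 = i≡1
  ... | inj₂ refl = ⊥-elim (q∤s i∣s)

module Congruence where

  open Primes using (coprime⇒*∣)
  import Data.Nat as ℕ
  open import Data.Nat using (suc)
  open import Data.Nat.Divisibility using (_∣_; _∣0; 1∣_)
  import Data.Nat.Divisibility as ℕ
  open import Data.Nat.DivMod using (_%_; _/_; m≡m%n+[m/n]*n; [m+kn]%n≡m%n)
  open import Data.Nat.Coprimality using (Coprime)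
  open import Data.Nat.Primality using (Prime; euclidsLemma)
  open import Data.Integer using (ℤ; +_; -[1+_]; 0ℤ; 1ℤ; -1ℤ; _+_; _*_; -_; _-_; ∣_∣)
  import Data.Integer.Properties as ℤ
  import Data.Integer.Divisibility.Signed as ℤ
  open import Data.Integer.Divisibility.Signed using (∣ᵤ⇒∣; ∣⇒∣ᵤ)
  open import Data.Integer.Tactic.RingSolver using (solve-∀)
  import Data.Sum as Sum
  open import Data.Sum using (_⊎_)
  open import Data.Empty using (⊥-elim)
  open import Relation.Nullary using (¬_)
  open import Relation.Binary.Bundles using (Setoid)

  infix 4 _≡_mod_

  -- a record rather than a synonym for the divisibility, so that a, b and m can be inferred
  record _≡_mod_ (a b : ℤ) (m : ℕ) : Set where
    constructor divides-difference
    field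
      modulus∣difference : + m ℤ.∣ a - b

  module _ {m : ℕ} where

    mod-reflexive : ∀ {a b} → a ≡ b → a ≡ b mod m
    mod-reflexive {a} refl = divides-difference (subst (+ m ℤ.∣_) (sym (ℤ.+-inverseʳ a)) (∣ᵤ⇒∣ (m ∣0)))

    mod-refl : ∀ {a} → a ≡ a mod m
    mod-refl = mod-reflexive refl

    mod-sym : ∀ {a b} → a ≡ b mod m → b ≡ a mod m
    mod-sym {a} {b} (divides-difference m∣a-b) =
      divides-difference (subst (+ m ℤ.∣_) (negate-diff a b) (ℤ.∣m⇒∣-m m∣a-b))
      where negate-diff : ∀ a b → - (a - b) ≡ b - a
            negate-diff = solve-∀

    mod-trans : ∀ {a b c} → a ≡ b mod m → b ≡ c mod m → a ≡ c mod m
    mod-trans {a} {b} {c} (divides-difference m∣a-b) (divides-difference m∣b-c) =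
      divides-difference (subst (+ m ℤ.∣_) (telescope a b c) (ℤ.∣m∣n⇒∣m+n m∣a-b m∣b-c))
      where telescope : ∀ a b c → (a - b) + (b - c) ≡ a - c
            telescope = solve-∀

    mod-setoid : Setoid _ _
    mod-setoid = record
      { Carrier = ℤ
      ; _≈_ = _≡_mod m
      ; isEquivalence = record { refl = mod-refl ; sym = mod-sym ; trans = mod-trans }
      }

    mod-+-cong : ∀ {a b c d} → a ≡ b mod m → c ≡ d mod m → a + c ≡ b + d mod m
    mod-+-cong {a} {b} {c} {d} (divides-difference m∣a-b) (divides-difference m∣c-d) =
      divides-difference (subst (+ m ℤ.∣_) (regroup a b c d) (ℤ.∣m∣n⇒∣m+n m∣a-b m∣c-d))
      where regroup : ∀ a b c d → (a - b) + (c - d) ≡ (a + c) - (b + d)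
            regroup = solve-∀

    mod-*-cong : ∀ {a b c d} → a ≡ b mod m → c ≡ d mod m → a * c ≡ b * d mod m
    mod-*-cong {a} {b} {c} {d} (divides-difference m∣a-b) (divides-difference m∣c-d) =
      divides-difference (subst (+ m ℤ.∣_) (regroup a b c d)
        (ℤ.∣m∣n⇒∣m+n (ℤ.∣m⇒∣m*n c m∣a-b) (ℤ.∣n⇒∣m*n b m∣c-d)))
      where regroup : ∀ a b c d → (a - b) * c + b * (c - d) ≡ a * c - b * d
            regroup = solve-∀

    mod-*-congˡ : ∀ c {a b} → a ≡ b mod m → c * a ≡ c * b mod m
    mod-*-congˡ c = mod-*-cong (mod-refl {c})

    mod-neg-cong : ∀ {a b} → a ≡ b mod m → - a ≡ - b mod m
    mod-neg-cong {a} {b} (divides-difference m∣a-b) =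
      divides-difference (subst (+ m ℤ.∣_) (regroup a b) (ℤ.∣m⇒∣-m m∣a-b))
      where regroup : ∀ a b → - (a - b) ≡ - a - - b
            regroup = solve-∀

    mod-absorbʳ : ∀ {a d} → + m ℤ.∣ d → a + d ≡ a mod m
    mod-absorbʳ {a} {d} m∣d = divides-difference (subst (+ m ℤ.∣_) (cancel a d) m∣d)
      where cancel : ∀ a d → d ≡ a + d - a
            cancel = solve-∀

  mod-1 : ∀ {a b} → a ≡ b mod 1
  mod-1 {a} {b} = divides-difference (∣ᵤ⇒∣ (1∣ ∣ a - b ∣))

  mod-∣ : ∀ {d m a b} → d ∣ m → a ≡ b mod m → a ≡ b mod d
  mod-∣ d∣m (divides-difference m∣a-b) = divides-difference (ℤ.∣-trans (∣ᵤ⇒∣ d∣m) m∣a-b)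

  mod-coprime-* : ∀ {m n a b} → Coprime m n → a ≡ b mod m → a ≡ b mod n → a ≡ b mod m ℕ.* n
  mod-coprime-* coprime (divides-difference m∣a-b) (divides-difference n∣a-b) =
    divides-difference (∣ᵤ⇒∣ (coprime⇒*∣ coprime (∣⇒∣ᵤ m∣a-b) (∣⇒∣ᵤ n∣a-b)))

  *-pres-∣ : ∀ {a b u v} → + a ℤ.∣ u → + b ℤ.∣ v → + (a ℕ.* b) ℤ.∣ u * v
  *-pres-∣ {a} {b} {u} {v} a∣u b∣v =
    ∣ᵤ⇒∣ (subst (a ℕ.* b ∣_) (sym (ℤ.abs-* u v)) (ℕ.*-pres-∣ (∣⇒∣ᵤ a∣u) (∣⇒∣ᵤ b∣v)))

  ∣⇒≡0 : ∀ {m a} → + m ℤ.∣ a → a ≡ 0ℤ mod m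
  ∣⇒≡0 {m} {a} m∣a = divides-difference (subst (+ m ℤ.∣_) (sym (ℤ.+-identityʳ a)) m∣a)

  ≡0⇒∣ : ∀ {m a} → a ≡ 0ℤ mod m → + m ℤ.∣ a
  ≡0⇒∣ {m} {a} (divides-difference m∣a-0) = subst (+ m ℤ.∣_) (ℤ.+-identityʳ a) m∣a-0

  pos-+-* : ∀ a b c → + (a ℕ.+ b ℕ.* c) ≡ + a + + b * + c
  pos-+-* a b c = trans (ℤ.pos-+ a (b ℕ.* c)) (cong (_+_ (+ a)) (ℤ.pos-* b c))

  ≡+km⇒%≡% : ∀ {m} .{{_ : ℕ.NonZero m}} a b k → + a ≡ + b + + k * + m → a % m ≡ b % m
  ≡+km⇒%≡% {m} a b k a≡b+km = trans (cong (_% m) (ℤ.+-injective (trans a≡b+km (sym (pos-+-* b k m)))))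
                                   ([m+kn]%n≡m%n b k m)

  +[m+kn]≡+m : ∀ a k m → + (a ℕ.+ k ℕ.* m) ≡ + a mod m
  +[m+kn]≡+m a k m = mod-trans (mod-reflexive (pos-+-* a k m)) (mod-absorbʳ (ℤ.∣n⇒∣m*n (+ k) ℤ.∣-refl))

  %≡%⇒mod : ∀ {m} .{{_ : ℕ.NonZero m}} a b → a % m ≡ b % m → + a ≡ + b mod m
  %≡%⇒mod {m} a b a%m≡b%m = begin
    + a                          ≡⟨ cong +_ (m≡m%n+[m/n]*n a m) ⟩
    + (a % m ℕ.+ a / m ℕ.* m)    ≈⟨ +[m+kn]≡+m (a % m) (a / m) m ⟩
    + (a % m)                    ≡⟨ cong +_ a%m≡b%m ⟩
    + (b % m)                    ≈⟨ +[m+kn]≡+m (b % m) (b / m) m ⟨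
    + (b % m ℕ.+ b / m ℕ.* m)    ≡⟨ cong +_ (m≡m%n+[m/n]*n b m) ⟨
    + b                          ∎
    where open import Relation.Binary.Reasoning.Setoid (mod-setoid {m})

  mod⇒%≡% : ∀ {m} .{{_ : ℕ.NonZero m}} a b → + a ≡ + b mod m → a % m ≡ b % m
  mod⇒%≡% {m} a b (divides-difference (ℤ.divides (+ k) a-b≡km)) =
    ≡+km⇒%≡% {m} a b k (trans (move (+ a) (+ b)) (cong (_+_ (+ b)) a-b≡km))
    where
      move : ∀ a b → a ≡ b + (a - b)
      move = solve-∀
  mod⇒%≡% {m} a b (divides-difference (ℤ.divides -[1+ k ] a-b≡-km)) =
    sym (≡+km⇒%≡% {m} b a (suc k)
      (trans (move (+ a) (+ b)) (trans (cong (_-_ (+ a)) a-b≡-km) (minus-negative (+ a) (+ suc k) (+ m)))))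
    where
      move : ∀ a b → b ≡ a - (a - b)
      move = solve-∀
      minus-negative : ∀ a k m → a - (- k * m) ≡ a + k * m
      minus-negative = solve-∀

  euclidsLemma-ℤ : ∀ {p} i j → Prime p → + p ℤ.∣ i * j → + p ℤ.∣ i ⊎ + p ℤ.∣ j
  euclidsLemma-ℤ i j p-prime p∣ij =
    Sum.map ∣ᵤ⇒∣ ∣ᵤ⇒∣
      (euclidsLemma ∣ i ∣ ∣ j ∣ p-prime (subst (_ ∣_) (ℤ.abs-* i j) (∣⇒∣ᵤ p∣ij)))

  mod-cancelˡ : ∀ {p a b} c → Prime p → ¬ p ∣ c → + c * a ≡ + c * b mod p → a ≡ b mod p
  mod-cancelˡ {p} {a} {b} c p-prime p∤c (divides-difference p∣ca-cb) =
    Sum.[ (λ p∣c → ⊥-elim (p∤c (∣⇒∣ᵤ p∣c))) , divides-difference ]′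
      (euclidsLemma-ℤ (+ c) (a - b) p-prime (subst (+ p ℤ.∣_) (factor (+ c) a b) p∣ca-cb))
    where factor : ∀ c a b → c * a - c * b ≡ c * (a - b)
          factor = solve-∀

  square≡1⇒≡±1 : ∀ {p x} → Prime p → x * x ≡ 1ℤ mod p → x ≡ 1ℤ mod p ⊎ x ≡ -1ℤ mod p
  square≡1⇒≡±1 {p} {x} p-prime (divides-difference p∣x²-1) =
    Sum.map divides-difference (λ p∣x+1 → divides-difference (subst (+ p ℤ.∣_) (plus-minus x) p∣x+1))
      (euclidsLemma-ℤ (x - 1ℤ) (x + 1ℤ) p-prime (subst (+ p ℤ.∣_) (difference-of-squares x) p∣x²-1))
    where difference-of-squares : ∀ x → x * x - 1ℤ ≡ (x - 1ℤ) * (x + 1ℤ)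
          difference-of-squares = solve-∀
          plus-minus : ∀ x → x + 1ℤ ≡ x - -1ℤ
          plus-minus = solve-∀

module PellNumbers where

  open import Data.Nat using (zero; suc; _+_; _*_)
  open import Data.Nat.Tactic.RingSolver using (solve-∀)

  -- Q n + P n √2 = (1 + √2) ^ n
  Q : ℕ → ℕ
  Q zero = 1
  Q (suc n) = Q n + 2 * P n

  P-suc : ∀ n → P (suc n) ≡ Q n + P n
  P-suc zero = refl
  P-suc (suc n) rewrite P-suc n = expand (Q n) (P n)
    where expand : ∀ q p → 2 * (q + p) + p ≡ q + 2 * p + (q + p)
          expand = solve-∀

  P-Q-+ : ∀ m n → P (m + n) ≡ Q m * P n + P m * Q n × Q (m + n) ≡ Q m * Q n + 2 * (P m * P n)
  P-Q-+ zero n = expand-P (P n) (Q n) , expand-Q (Q n)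
    where expand-P : ∀ p q → p ≡ 1 * p + 0 * q
          expand-P = solve-∀
          expand-Q : ∀ q → q ≡ 1 * q + 2 * (0 * 0)
          expand-Q = solve-∀
  P-Q-+ (suc m) n with P-Q-+ m n
  ... | P[m+n] , Q[m+n] = P[1+m+n] , Q[1+m+n]
    where
      open ≡-Reasoning
      P[1+m+n] : P (suc m + n) ≡ Q (suc m) * P n + P (suc m) * Q n
      P[1+m+n] = begin
        P (suc (m + n))            ≡⟨ P-suc (m + n) ⟩
        Q (m + n) + P (m + n)      ≡⟨ cong₂ _+_ Q[m+n] P[m+n] ⟩
        Q m * Q n + 2 * (P m * P n) + (Q m * P n + P m * Q n)
                                   ≡⟨ regroup (Q m) (P m) (Q n) (P n) ⟩
        (Q m + 2 * P m) * P n + (Q m + P m) * Q n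
                                   ≡⟨ cong (λ x → (Q m + 2 * P m) * P n + x * Q n) (P-suc m) ⟨
        Q (suc m) * P n + P (suc m) * Q n ∎
        where regroup : ∀ qm pm qn pn → qm * qn + 2 * (pm * pn) + (qm * pn + pm * qn)
                                        ≡ (qm + 2 * pm) * pn + (qm + pm) * qn
              regroup = solve-∀
      Q[1+m+n] : Q (suc m + n) ≡ Q (suc m) * Q n + 2 * (P (suc m) * P n)
      Q[1+m+n] = begin
        Q (m + n) + 2 * P (m + n)  ≡⟨ cong₂ (λ x y → x + 2 * y) Q[m+n] P[m+n] ⟩
        Q m * Q n + 2 * (P m * P n) + 2 * (Q m * P n + P m * Q n)
                                   ≡⟨ regroup (Q m) (P m) (Q n) (P n) ⟩
        (Q m + 2 * P m) * Q n + 2 * ((Q m + P m) * P n)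
                                   ≡⟨ cong (λ x → (Q m + 2 * P m) * Q n + 2 * (x * P n)) (P-suc m) ⟨
        Q (suc m) * Q n + 2 * (P (suc m) * P n) ∎
        where regroup : ∀ qm pm qn pn → qm * qn + 2 * (pm * pn) + 2 * (qm * pn + pm * qn)
                                        ≡ (qm + 2 * pm) * qn + 2 * ((qm + pm) * pn)
              regroup = solve-∀

  P-+ : ∀ m n → P (m + n) ≡ Q m * P n + P m * Q n
  P-+ m n = proj₁ (P-Q-+ m n)

  Q-+ : ∀ m n → Q (m + n) ≡ Q m * Q n + 2 * (P m * P n)
  Q-+ m n = proj₂ (P-Q-+ m n)

module Periods where

  open Congruence
  open PellNumbers
  import Data.Nat as ℕ
  open import Data.Nat using (zero; suc)
  import Data.Nat.Properties as ℕ
  open import Data.Nat.Divisibility using (_∣_; *-monoˡ-∣; m%n≡0⇒n∣m)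
  open import Data.Nat.DivMod using (_%_; _/_; m≡m%n+[m/n]*n; m%n<n)
  open import Data.Nat.Coprimality using (Coprime)
  open import Data.Integer using (ℤ; +_; 0ℤ; 1ℤ; _+_; _*_; -_; _-_)
  import Data.Integer.Properties as ℤ
  import Data.Integer.Divisibility.Signed as ℤ
  open import Data.Integer.Tactic.RingSolver using (solve-∀)
  open import Data.Empty using (⊥-elim)
  open import Relation.Nullary using (yes; no)

  +P-suc : ∀ n → + P (suc n) ≡ + Q n + + P n
  +P-suc n = trans (cong +_ (P-suc n)) (ℤ.pos-+ (Q n) (P n))

  +Q-suc : ∀ n → + Q (suc n) ≡ + Q n + + 2 * + P n
  +Q-suc n = pos-+-* (Q n) 2 (P n)

  +P-+ : ∀ m n → + P (m ℕ.+ n) ≡ + Q m * + P n + + P m * + Q n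
  +P-+ m n = trans (cong +_ (P-+ m n))
    (trans (ℤ.pos-+ (Q m ℕ.* P n) (P m ℕ.* Q n)) (cong₂ _+_ (ℤ.pos-* (Q m) (P n)) (ℤ.pos-* (P m) (Q n))))

  +Q-+ : ∀ m n → + Q (m ℕ.+ n) ≡ + Q m * + Q n + + 2 * (+ P m * + P n)
  +Q-+ m n = trans (cong +_ (Q-+ m n))
    (trans (ℤ.pos-+ (Q m ℕ.* Q n) (2 ℕ.* (P m ℕ.* P n))) (cong₂ _+_ (ℤ.pos-* (Q m) (Q n))
      (trans (ℤ.pos-* 2 (P m ℕ.* P n)) (cong (_*_ (+ 2)) (ℤ.pos-* (P m) (P n))))))

  Period : ℕ → ℕ → Set
  Period m T = ∀ n → + P (n ℕ.+ T) ≡ + P n mod m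

  module _ {m T : ℕ} where

    open import Relation.Binary.Reasoning.Setoid (mod-setoid {m})

    period-intro : + P T ≡ 0ℤ mod m → + Q T ≡ 1ℤ mod m → Period m T
    period-intro P[T]≡0 Q[T]≡1 n = begin
      + P (n ℕ.+ T)                  ≡⟨ +P-+ n T ⟩
      + Q n * + P T + + P n * + Q T  ≈⟨ mod-+-cong (mod-*-congˡ (+ Q n) P[T]≡0) (mod-*-congˡ (+ P n) Q[T]≡1) ⟩
      + Q n * 0ℤ + + P n * 1ℤ        ≡⟨ simplify (+ Q n) (+ P n) ⟩
      + P n                          ∎
      where simplify : ∀ q p → q * 0ℤ + p * 1ℤ ≡ p
            simplify = solve-∀

    period⇒P≡0 : Period m T → + P T ≡ 0ℤ mod m
    period⇒P≡0 period = period 0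

    period⇒Q≡1 : Period m T → + Q T ≡ 1ℤ mod m
    period⇒Q≡1 period = begin
      + Q T                     ≡⟨ difference (+ Q T) (+ P T) ⟩
      (+ Q T + + P T) - + P T   ≡⟨ cong (_- + P T) (+P-suc T) ⟨
      + P (suc T) - + P T       ≈⟨ mod-+-cong (period 1) (mod-neg-cong (period 0)) ⟩
      1ℤ - 0ℤ                   ≡⟨⟩
      1ℤ                        ∎
      where difference : ∀ q p → q ≡ (q + p) - p
            difference = solve-∀

  period-* : ∀ {m T} → Period m T → ∀ k → Period m (k ℕ.* T)
  period-* {m} {T} period zero n = mod-reflexive (cong (λ i → + P i) (ℕ.+-identityʳ n))
  period-* {m} {T} period (suc k) n = begin
    + P (n ℕ.+ (T ℕ.+ k ℕ.* T))  ≡⟨ cong (λ i → + P i) (ℕ.+-assoc n T (k ℕ.* T)) ⟨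
    + P (n ℕ.+ T ℕ.+ k ℕ.* T)    ≈⟨ period-* period k (n ℕ.+ T) ⟩
    + P (n ℕ.+ T)                ≈⟨ period n ⟩
    + P n                        ∎
    where open import Relation.Binary.Reasoning.Setoid (mod-setoid {m})

  period-cancelʳ : ∀ {m T U} → Period m (T ℕ.+ U) → Period m U → Period m T
  period-cancelʳ {m} {T} {U} period[T+U] period[U] n = begin
    + P (n ℕ.+ T)                ≈⟨ period[U] (n ℕ.+ T) ⟨
    + P (n ℕ.+ T ℕ.+ U)          ≡⟨ cong (λ i → + P i) (ℕ.+-assoc n T U) ⟩
    + P (n ℕ.+ (T ℕ.+ U))        ≈⟨ period[T+U] n ⟩
    + P n                        ∎
    where open import Relation.Binary.Reasoning.Setoid (mod-setoid {m})

  period-∣ : ∀ {d m T} → d ∣ m → Period m T → Period d T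
  period-∣ d∣m period n = mod-∣ d∣m (period n)

  period-coprime-* : ∀ {m n T} → Coprime m n → Period m T → Period n T → Period (m ℕ.* n) T
  period-coprime-* coprime period[m] period[n] i = mod-coprime-* coprime (period[m] i) (period[n] i)

  isPeriod⇒period : ∀ {m} .{{_ : ℕ.NonZero m}} {T} → IsPeriodMod m T → Period m T
  isPeriod⇒period (_ , period) n = %≡%⇒mod _ _ (period n)

  period⇒isPeriod : ∀ {m} .{{_ : ℕ.NonZero m}} {T} → 0 ℕ.< T → Period m T → IsPeriodMod m T
  period⇒isPeriod T>0 period = T>0 , λ n → mod⇒%≡% _ _ (period n)

  shortest-period-∣ : ∀ {m T} .{{_ : ℕ.NonZero m}} → IsShortestPeriodMod m m → Period m T → m ∣ T
  shortest-period-∣ {m} {T} (m-period , m-least) period[T] with T % m ℕ.≟ 0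
  ... | yes T%m≡0 = m%n≡0⇒n∣m T m T%m≡0
  ... | no T%m≢0 =
    ⊥-elim (ℕ.<⇒≱ (m%n<n T m) (m-least (T % m) (period⇒isPeriod (ℕ.n≢0⇒n>0 T%m≢0) period[T%m])))
    where
      period[T%m] : Period m (T % m)
      period[T%m] = period-cancelʳ (subst (Period m) (m≡m%n+[m/n]*n T m) period[T])
                                   (period-* (isPeriod⇒period m-period) (T / m))

  -- With u = P T and v = Q T - 1 divisible by s, this is (1 + v + u √2) ^ k ≡ 1 + k (v + u √2) modulo s².
  period-powers : ∀ {s T} → + s ℤ.∣ + P T → + s ℤ.∣ + Q T - 1ℤ → ∀ k →
                  + P (k ℕ.* T) ≡ + k * + P T mod s ℕ.* s ×
                  + Q (k ℕ.* T) ≡ 1ℤ + + k * (+ Q T - 1ℤ) mod s ℕ.* s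
  period-powers {s} {T} s∣u s∣v zero = mod-refl , mod-refl
  period-powers {s} {T} s∣u s∣v (suc k) with period-powers s∣u s∣v k
  ... | P[kT] , Q[kT] = P[T+kT] , Q[T+kT]
    where
      open import Relation.Binary.Reasoning.Setoid (mod-setoid {s ℕ.* s})
      u v : ℤ
      u = + P T
      v = + Q T - 1ℤ
      ss∣uv : ∀ c → + (s ℕ.* s) ℤ.∣ c * (u * v)
      ss∣uv c = ℤ.∣n⇒∣m*n c (*-pres-∣ s∣u s∣v)
      ss∣u²+v² : ∀ c d → + (s ℕ.* s) ℤ.∣ c * (v * v) + d * (u * u)
      ss∣u²+v² c d =
        ℤ.∣m∣n⇒∣m+n (ℤ.∣n⇒∣m*n c (*-pres-∣ s∣v s∣v)) (ℤ.∣n⇒∣m*n d (*-pres-∣ s∣u s∣u))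
      P[T+kT] : + P (T ℕ.+ k ℕ.* T) ≡ + suc k * u mod s ℕ.* s
      P[T+kT] = begin
        + P (T ℕ.+ k ℕ.* T)                             ≡⟨ +P-+ T (k ℕ.* T) ⟩
        + Q T * + P (k ℕ.* T) + u * + Q (k ℕ.* T)
                                                        ≈⟨ mod-+-cong (mod-*-congˡ (+ Q T) P[kT]) (mod-*-congˡ u Q[kT]) ⟩
        + Q T * (+ k * u) + u * (1ℤ + + k * v)          ≡⟨ expand (+ Q T) u (+ k) ⟩
        (1ℤ + + k) * u + + 2 * + k * (u * v)            ≈⟨ mod-absorbʳ (ss∣uv (+ 2 * + k)) ⟩
        (1ℤ + + k) * u                                  ≡⟨ cong (_* u) (ℤ.pos-+ 1 k) ⟨
        + suc k * u                                     ∎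
        where expand : ∀ q u k → q * (k * u) + u * (1ℤ + k * (q - 1ℤ))
                                 ≡ (1ℤ + k) * u + + 2 * k * (u * (q - 1ℤ))
              expand = solve-∀
      Q[T+kT] : + Q (T ℕ.+ k ℕ.* T) ≡ 1ℤ + + suc k * v mod s ℕ.* s
      Q[T+kT] = begin
        + Q (T ℕ.+ k ℕ.* T)                             ≡⟨ +Q-+ T (k ℕ.* T) ⟩
        + Q T * + Q (k ℕ.* T) + + 2 * (u * + P (k ℕ.* T))
          ≈⟨ mod-+-cong (mod-*-congˡ (+ Q T) Q[kT]) (mod-*-congˡ (+ 2) (mod-*-congˡ u P[kT])) ⟩
        + Q T * (1ℤ + + k * v) + + 2 * (u * (+ k * u))  ≡⟨ expand (+ Q T) u (+ k) ⟩
        1ℤ + (1ℤ + + k) * v + (+ k * (v * v) + + 2 * + k * (u * u))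
                                                        ≈⟨ mod-absorbʳ (ss∣u²+v² (+ k) (+ 2 * + k)) ⟩
        1ℤ + (1ℤ + + k) * v                             ≡⟨ cong (λ c → 1ℤ + c * v) (ℤ.pos-+ 1 k) ⟨
        1ℤ + + suc k * v                                ∎
        where expand : ∀ q u k → q * (1ℤ + k * (q - 1ℤ)) + + 2 * (u * (k * u))
                                 ≡ 1ℤ + (1ℤ + k) * (q - 1ℤ) + (k * ((q - 1ℤ) * (q - 1ℤ)) + + 2 * k * (u * u))
              expand = solve-∀

  period-lift : ∀ {s T q} → Period s T → q ∣ s → Period (q ℕ.* s) (q ℕ.* T)
  period-lift {s} {T} {q} period q∣s = period-intro P[qT]≡0 Q[qT]≡1
    where
      s∣u : + s ℤ.∣ + P T
      s∣u = ≡0⇒∣ (period⇒P≡0 period)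
      s∣v : + s ℤ.∣ + Q T - 1ℤ
      s∣v = _≡_mod_.modulus∣difference (period⇒Q≡1 period)
      qs∣ss : q ℕ.* s ∣ s ℕ.* s
      qs∣ss = *-monoˡ-∣ s q∣s
      qs∣q* : ∀ {x} → + s ℤ.∣ x → + (q ℕ.* s) ℤ.∣ + q * x
      qs∣q* {x} s∣x = subst (ℤ._∣ + q * x) (sym (ℤ.pos-* q s)) (ℤ.*-monoʳ-∣ (+ q) s∣x)
      P[qT]≡0 : + P (q ℕ.* T) ≡ 0ℤ mod q ℕ.* s
      P[qT]≡0 = mod-trans (mod-∣ qs∣ss (proj₁ (period-powers s∣u s∣v q))) (∣⇒≡0 (qs∣q* s∣u))
      Q[qT]≡1 : + Q (q ℕ.* T) ≡ 1ℤ mod q ℕ.* s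
      Q[qT]≡1 = mod-trans (mod-∣ qs∣ss (proj₂ (period-powers s∣u s∣v q))) (mod-absorbʳ (qs∣q* s∣v))

  period-double : ∀ {m T c} → + P T ≡ 0ℤ mod m → + Q T ≡ c mod m → c * c ≡ 1ℤ mod m →
                  Period m (2 ℕ.* T)
  period-double {m} {T} {c} P[T]≡0 Q[T]≡c c²≡1 =
    subst (Period m) (cong (T ℕ.+_) (sym (ℕ.+-identityʳ T))) (period-intro P[2T]≡0 Q[2T]≡1)
    where
      open import Relation.Binary.Reasoning.Setoid (mod-setoid {m})
      P[2T]≡0 : + P (T ℕ.+ T) ≡ 0ℤ mod m
      P[2T]≡0 = begin
        + P (T ℕ.+ T)                   ≡⟨ +P-+ T T ⟩
        + Q T * + P T + + P T * + Q T   ≈⟨ mod-+-cong (mod-*-cong Q[T]≡c P[T]≡0) (mod-*-cong P[T]≡0 Q[T]≡c) ⟩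
        c * 0ℤ + 0ℤ * c                 ≡⟨ vanish c ⟩
        0ℤ                              ∎
        where vanish : ∀ c → c * 0ℤ + 0ℤ * c ≡ 0ℤ
              vanish = solve-∀
      Q[2T]≡1 : + Q (T ℕ.+ T) ≡ 1ℤ mod m
      Q[2T]≡1 = begin
        + Q (T ℕ.+ T)                        ≡⟨ +Q-+ T T ⟩
        + Q T * + Q T + + 2 * (+ P T * + P T)
          ≈⟨ mod-+-cong (mod-*-cong Q[T]≡c Q[T]≡c) (mod-*-congˡ (+ 2) (mod-*-cong P[T]≡0 P[T]≡0)) ⟩
        c * c + + 2 * (0ℤ * 0ℤ)              ≡⟨ ℤ.+-identityʳ (c * c) ⟩
        c * c                                ≈⟨ c²≡1 ⟩
        1ℤ                                   ∎

module BinomialSums where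

  open PellNumbers

  open import Data.Nat using (zero; suc; _+_; _*_; _^_; s≤s; z≤n)
  import Data.Nat.Properties as ℕ
  open import Data.Nat.Divisibility
    using (_∣_; _∣0; ∣m∣n⇒∣m+n; ∣m⇒∣m*n; m∣m*n; ∣⇒≤; quotient; m∣n⇒n≡quotient*m)
  open import Data.Nat.Combinatorics using (_C_; nCn≡1; nC1≡n; k>n⇒nCk≡0; nCk+nC[k+1]≡[n+1]C[k+1])
  open import Data.Nat.Primality using (Prime; euclidsLemma)
  open import Data.Nat.Tactic.RingSolver using (solve-∀)
  open import Data.Sum using (inj₁; inj₂)
  open import Data.Empty using (⊥-elim)
  open import Function using (_∘_)

  ∑< : ℕ → (ℕ → ℕ) → ℕ
  ∑< zero f = 0
  ∑< (suc n) f = f 0 + ∑< n (f ∘ suc)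

  syntax ∑< n (λ j → e) = ∑[ j < n ] e

  ∑<-cong : ∀ n {f g} → (∀ j → f j ≡ g j) → ∑< n f ≡ ∑< n g
  ∑<-cong zero f≗g = refl
  ∑<-cong (suc n) f≗g = cong₂ _+_ (f≗g 0) (∑<-cong n (f≗g ∘ suc))

  ∑<-distrib-+ : ∀ n f g → ∑[ j < n ] (f j + g j) ≡ ∑< n f + ∑< n g
  ∑<-distrib-+ zero f g = refl
  ∑<-distrib-+ (suc n) f g = trans (cong (f 0 + g 0 +_) (∑<-distrib-+ n (f ∘ suc) (g ∘ suc)))
                                   (regroup (f 0) (g 0) (∑< n (f ∘ suc)) (∑< n (g ∘ suc)))
    where regroup : ∀ a b c d → a + b + (c + d) ≡ a + c + (b + d)
          regroup = solve-∀

  ∑<-distribˡ-* : ∀ n c f → ∑[ j < n ] (c * f j) ≡ c * ∑< n f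
  ∑<-distribˡ-* zero c f = sym (ℕ.*-zeroʳ c)
  ∑<-distribˡ-* (suc n) c f = trans (cong (c * f 0 +_) (∑<-distribˡ-* n c (f ∘ suc)))
                                    (sym (ℕ.*-distribˡ-+ c (f 0) (∑< n (f ∘ suc))))

  ∑<-last : ∀ n f → ∑< (suc n) f ≡ ∑< n f + f n
  ∑<-last zero f = ℕ.+-comm (f 0) 0
  ∑<-last (suc n) f = trans (cong (f 0 +_) (∑<-last n (f ∘ suc))) (sym (ℕ.+-assoc (f 0) _ _))

  ∑<-∣ : ∀ n {d} f → (∀ j → j < n → d ∣ f j) → d ∣ ∑< n f
  ∑<-∣ zero {d} f d∣f = d ∣0
  ∑<-∣ (suc n) f d∣f =
    ∣m∣n⇒∣m+n (d∣f 0 (s≤s z≤n)) (∑<-∣ n (f ∘ suc) (λ j j<n → d∣f (suc j) (s≤s j<n)))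

  binomialSum : ℕ → (ℕ → ℕ) → ℕ
  binomialSum n g = ∑[ j < suc n ] ((n C j) * g j)

  binomialSum-suc : ∀ n g → binomialSum (suc n) g ≡ binomialSum n g + binomialSum n (g ∘ suc)
  binomialSum-suc n g = begin
    1 * g 0 + ∑[ j < suc n ] ((suc n C suc j) * g (suc j))
      ≡⟨ cong (1 * g 0 +_) (∑<-cong (suc n) (λ j → cong (_* g (suc j)) (sym (nCk+nC[k+1]≡[n+1]C[k+1] n j)))) ⟩
    1 * g 0 + ∑[ j < suc n ] ((n C j + n C suc j) * g (suc j))
      ≡⟨ cong (1 * g 0 +_) (trans (∑<-cong (suc n) (λ j → ℕ.*-distribʳ-+ (g (suc j)) (n C j) (n C suc j)))
                              (∑<-distrib-+ (suc n) (λ j → (n C j) * g (suc j)) shifted)) ⟩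
    1 * g 0 + (binomialSum n (g ∘ suc) + ∑< (suc n) shifted)
      ≡⟨ cong (λ x → 1 * g 0 + (binomialSum n (g ∘ suc) + x)) (∑<-last n shifted) ⟩
    1 * g 0 + (binomialSum n (g ∘ suc) + (∑< n shifted + (n C suc n) * g (suc n)))
      ≡⟨ cong (λ c → 1 * g 0 + (binomialSum n (g ∘ suc) + (∑< n shifted + c * g (suc n))))
              (k>n⇒nCk≡0 (ℕ.n<1+n n)) ⟩
    1 * g 0 + (binomialSum n (g ∘ suc) + (∑< n shifted + 0 * g (suc n)))
      ≡⟨ regroup (g 0) (binomialSum n (g ∘ suc)) (∑< n shifted) (g (suc n)) ⟩
    binomialSum n g + binomialSum n (g ∘ suc) ∎
    where
      open ≡-Reasoning
      shifted : ℕ → ℕ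
      shifted j = (n C suc j) * g (suc j)
      regroup : ∀ a b c d → 1 * a + (b + (c + 0 * d)) ≡ 1 * a + c + b
      regroup = solve-∀

  binomialSum-*ˡ : ∀ n c g → binomialSum n (λ j → c * g j) ≡ c * binomialSum n g
  binomialSum-*ˡ n c g = trans (∑<-cong (suc n) (λ j → swap (n C j) c (g j)))
                                (∑<-distribˡ-* (suc n) c (λ j → (n C j) * g j))
    where swap : ∀ a b c → a * (b * c) ≡ b * (a * c)
          swap = solve-∀

  C-absorb : ∀ n k → suc k * (suc n C suc k) ≡ suc n * (n C k)
  C-absorb zero zero = refl
  C-absorb zero (suc k) = ℕ.*-zeroʳ (suc (suc k))
  C-absorb (suc n) zero =
    trans (ℕ.*-identityˡ (suc (suc n) C 1)) (trans (nC1≡n (suc (suc n))) (sym (ℕ.*-identityʳ (suc (suc n)))))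
  C-absorb (suc n) (suc k) = begin
    suc (suc k) * (suc (suc n) C suc (suc k))
      ≡⟨ cong (suc (suc k) *_) (nCk+nC[k+1]≡[n+1]C[k+1] (suc n) (suc k)) ⟨
    suc (suc k) * ((suc n C suc k) + (suc n C suc (suc k)))
      ≡⟨ split (suc k) (suc n C suc k) (suc n C suc (suc k)) ⟩
    suc k * (suc n C suc k) + (suc n C suc k) + suc (suc k) * (suc n C suc (suc k))
      ≡⟨ cong₂ (λ x y → x + (suc n C suc k) + y) (C-absorb n k) (C-absorb n (suc k)) ⟩
    suc n * (n C k) + (suc n C suc k) + suc n * (n C suc k)
      ≡⟨ cong (λ x → suc n * (n C k) + x + suc n * (n C suc k)) (nCk+nC[k+1]≡[n+1]C[k+1] n k) ⟨
    suc n * (n C k) + ((n C k) + (n C suc k)) + suc n * (n C suc k)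
      ≡⟨ merge n (n C k) (n C suc k) ⟩
    suc (suc n) * ((n C k) + (n C suc k))
      ≡⟨ cong (suc (suc n) *_) (nCk+nC[k+1]≡[n+1]C[k+1] n k) ⟩
    suc (suc n) * (suc n C suc k) ∎
    where
      open ≡-Reasoning
      split : ∀ k a b → suc k * (a + b) ≡ k * a + a + suc k * b
      split = solve-∀
      merge : ∀ n a b → suc n * a + (a + b) + suc n * b ≡ suc (suc n) * (a + b)
      merge = solve-∀

  prime∣C : ∀ {q j} → Prime q → 0 < j → j < q → q ∣ q C j
  prime∣C {suc n} {suc k} q-prime _ j<q
    with euclidsLemma (suc k) (suc n C suc k) q-prime (subst (suc n ∣_) (sym (C-absorb n k)) (m∣m*n (n C k)))
  ... | inj₁ q∣j = ⊥-elim (ℕ.<⇒≱ j<q (∣⇒≤ q∣j))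
  ... | inj₂ q∣C = q∣C

  binomialSum-prime : ∀ {q} g → Prime q → ∃[ K ] binomialSum q g ≡ g 0 + g q + K * q
  binomialSum-prime {suc n} g q-prime = quotient q∣middle , (begin
    1 * g 0 + ∑< (suc n) middle
      ≡⟨ cong (1 * g 0 +_) (∑<-last n middle) ⟩
    1 * g 0 + (∑< n middle + (suc n C suc n) * g (suc n))
      ≡⟨ cong₂ (λ x c → 1 * g 0 + (x + c * g (suc n))) (m∣n⇒n≡quotient*m q∣middle) (nCn≡1 (suc n)) ⟩
    1 * g 0 + (quotient q∣middle * suc n + 1 * g (suc n))
      ≡⟨ regroup (g 0) (g (suc n)) (quotient q∣middle * suc n) ⟩
    g 0 + g (suc n) + quotient q∣middle * suc n ∎)
    where
      open ≡-Reasoning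
      middle : ℕ → ℕ
      middle j = (suc n C suc j) * g (suc j)
      q∣middle : suc n ∣ ∑< n middle
      q∣middle = ∑<-∣ n middle (λ j j<n → ∣m⇒∣m*n (g (suc j)) (prime∣C q-prime (s≤s z≤n) (s≤s j<n)))
      regroup : ∀ a b c → 1 * a + (c + 1 * b) ≡ a + b + c
      regroup = solve-∀

  -- (√2) ^ j = ratCoeff j + surdCoeff j · √2
  ratCoeff surdCoeff : ℕ → ℕ
  ratCoeff zero = 1
  ratCoeff (suc j) = 2 * surdCoeff j
  surdCoeff zero = 0
  surdCoeff (suc j) = ratCoeff j

  P-Q-binomial : ∀ n → P n ≡ binomialSum n surdCoeff × Q n ≡ binomialSum n ratCoeff
  P-Q-binomial zero = refl , refl
  P-Q-binomial (suc n) with P-Q-binomial n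
  ... | P≡ , Q≡ = P[1+n] , Q[1+n]
    where
      open ≡-Reasoning
      P[1+n] : P (suc n) ≡ binomialSum (suc n) surdCoeff
      P[1+n] = begin
        P (suc n)                                      ≡⟨ P-suc n ⟩
        Q n + P n                                      ≡⟨ cong₂ _+_ Q≡ P≡ ⟩
        binomialSum n ratCoeff + binomialSum n surdCoeff
                                                       ≡⟨ ℕ.+-comm (binomialSum n ratCoeff) (binomialSum n surdCoeff) ⟩
        binomialSum n surdCoeff + binomialSum n ratCoeff ≡⟨ binomialSum-suc n surdCoeff ⟨
        binomialSum (suc n) surdCoeff                  ∎
      Q[1+n] : Q (suc n) ≡ binomialSum (suc n) ratCoeff
      Q[1+n] = begin
        Q n + 2 * P n                                  ≡⟨ cong₂ (λ x y → x + 2 * y) Q≡ P≡ ⟩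
        binomialSum n ratCoeff + 2 * binomialSum n surdCoeff
                                                       ≡⟨ cong (binomialSum n ratCoeff +_) (binomialSum-*ˡ n 2 surdCoeff) ⟨
        binomialSum n ratCoeff + binomialSum n (λ j → 2 * surdCoeff j)
                                                       ≡⟨ binomialSum-suc n ratCoeff ⟨
        binomialSum (suc n) ratCoeff                   ∎

  2^-binomial : ∀ n → 2 ^ n ≡ binomialSum n (λ _ → 1)
  2^-binomial zero = refl
  2^-binomial (suc n) =
    trans (cong (2 *_) (2^-binomial n))
          (trans (double (binomialSum n (λ _ → 1))) (sym (binomialSum-suc n (λ _ → 1))))
    where double : ∀ x → 2 * x ≡ x + x
          double = solve-∀

  ratCoeff-surdCoeff-even : ∀ r → ratCoeff (2 * r) ≡ 2 ^ r × surdCoeff (2 * r) ≡ 0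
  ratCoeff-surdCoeff-even zero = refl , refl
  ratCoeff-surdCoeff-even (suc r) with ratCoeff-surdCoeff-even r
  ... | rat≡ , surd≡ = subst (λ i → ratCoeff i ≡ 2 ^ suc r × surdCoeff i ≡ 0) (sym (ℕ.*-suc 2 r))
                             (cong (2 *_) rat≡ , cong (2 *_) surd≡)

module PrimePeriods where

  open Congruence
  open PellNumbers
  open Periods
  open BinomialSums
  open Primes
  import Data.Nat as ℕ
  open import Data.Nat using (suc; _∸_)
  import Data.Nat.Properties as ℕ
  open import Data.Nat.Primality using (Prime)
  open import Data.Integer using (+_; 0ℤ; 1ℤ; -1ℤ; _+_; _*_; _-_)
  import Data.Integer.Properties as ℤ
  open import Data.Integer.Tactic.RingSolver using (solve-∀)
  open import Data.Sum using (_⊎_)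
  import Data.Sum as Sum
  open import Relation.Binary.PropositionalEquality using (_≢_)

  module Frobenius (r : ℕ) (q-prime : Prime (suc (2 ℕ.* r))) where

    q : ℕ
    q = suc (2 ℕ.* r)

    open import Relation.Binary.Reasoning.Setoid (mod-setoid {q})

    binomialSum-mod : ∀ g → + binomialSum q g ≡ + (g 0 ℕ.+ g q) mod q
    binomialSum-mod g with binomialSum-prime g q-prime
    ... | K , eq = mod-trans (mod-reflexive (cong +_ eq)) (+[m+kn]≡+m (g 0 ℕ.+ g q) K q)

    P[q] : + P q ≡ + (2 ℕ.^ r) mod q
    P[q] = begin
      + P q                             ≡⟨ cong +_ (proj₁ (P-Q-binomial q)) ⟩
      + binomialSum q surdCoeff         ≈⟨ binomialSum-mod surdCoeff ⟩
      + ratCoeff (2 ℕ.* r)              ≡⟨ cong +_ (proj₁ (ratCoeff-surdCoeff-even r)) ⟩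
      + (2 ℕ.^ r)                       ∎

    Q[q] : + Q q ≡ 1ℤ mod q
    Q[q] = begin
      + Q q                             ≡⟨ cong +_ (proj₂ (P-Q-binomial q)) ⟩
      + binomialSum q ratCoeff          ≈⟨ binomialSum-mod ratCoeff ⟩
      + suc (2 ℕ.* surdCoeff (2 ℕ.* r)) ≡⟨ cong (λ x → + suc (2 ℕ.* x)) (proj₂ (ratCoeff-surdCoeff-even r)) ⟩
      1ℤ                                ∎

    2^q : + (2 ℕ.^ q) ≡ + 2 mod q
    2^q = begin
      + (2 ℕ.^ q)                       ≡⟨ cong +_ (2^-binomial q) ⟩
      + binomialSum q (λ _ → 1)         ≈⟨ binomialSum-mod (λ _ → 1) ⟩
      + 2                               ∎

    period[q-1] : + (2 ℕ.^ r) ≡ 1ℤ mod q → Period q (2 ℕ.* r)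
    period[q-1] 2^r≡1 = period-intro P≡0 Q≡1
      where
        P[q]≡1 : + P q ≡ 1ℤ mod q
        P[q]≡1 = mod-trans P[q] 2^r≡1
        P≡0 : + P (2 ℕ.* r) ≡ 0ℤ mod q
        P≡0 = begin
          + P (2 ℕ.* r)                  ≡⟨ difference (+ Q (2 ℕ.* r)) (+ P (2 ℕ.* r)) ⟩
          (+ Q (2 ℕ.* r) + + 2 * + P (2 ℕ.* r)) - (+ Q (2 ℕ.* r) + + P (2 ℕ.* r))
                                         ≡⟨ cong₂ _-_ (+Q-suc (2 ℕ.* r)) (+P-suc (2 ℕ.* r)) ⟨
          + Q q - + P q                  ≈⟨ mod-+-cong Q[q] (mod-neg-cong P[q]≡1) ⟩
          0ℤ                             ∎
          where difference : ∀ a b → b ≡ (a + + 2 * b) - (a + b)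
                difference = solve-∀
        Q≡1 : + Q (2 ℕ.* r) ≡ 1ℤ mod q
        Q≡1 = begin
          + Q (2 ℕ.* r)                  ≡⟨ difference (+ Q (2 ℕ.* r)) (+ P (2 ℕ.* r)) ⟩
          + 2 * (+ Q (2 ℕ.* r) + + P (2 ℕ.* r)) - (+ Q (2 ℕ.* r) + + 2 * + P (2 ℕ.* r))
                                         ≡⟨ cong₂ (λ x y → + 2 * x - y) (+P-suc (2 ℕ.* r)) (+Q-suc (2 ℕ.* r)) ⟨
          + 2 * + P q - + Q q            ≈⟨ mod-+-cong (mod-*-congˡ (+ 2) P[q]≡1) (mod-neg-cong Q[q]) ⟩
          1ℤ                             ∎
          where difference : ∀ a b → a ≡ + 2 * (a + b) - (a + + 2 * b)
                difference = solve-∀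

    period[2q+2] : + (2 ℕ.^ r) ≡ -1ℤ mod q → Period q (2 ℕ.* suc q)
    period[2q+2] 2^r≡-1 = period-double P[q+1]≡0 Q[q+1]≡-1 (mod-reflexive refl)
      where
        P[q]≡-1 : + P q ≡ -1ℤ mod q
        P[q]≡-1 = mod-trans P[q] 2^r≡-1
        P[q+1]≡0 : + P (suc q) ≡ 0ℤ mod q
        P[q+1]≡0 = begin
          + P (suc q)     ≡⟨ +P-suc q ⟩
          + Q q + + P q   ≈⟨ mod-+-cong Q[q] P[q]≡-1 ⟩
          0ℤ              ∎
        Q[q+1]≡-1 : + Q (suc q) ≡ -1ℤ mod q
        Q[q+1]≡-1 = begin
          + Q (suc q)       ≡⟨ +Q-suc q ⟩
          + Q q + + 2 * + P q ≈⟨ mod-+-cong Q[q] (mod-*-congˡ (+ 2) P[q]≡-1) ⟩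
          -1ℤ               ∎

  oddPrime-period : ∀ {q} → Prime q → q ≢ 2 → Period q (q ∸ 1) ⊎ Period q (2 ℕ.* suc q)
  oddPrime-period {q} q-prime q≢2 with prime≢2⇒odd q-prime q≢2
  ... | r , refl = Sum.map (Frobenius.period[q-1] r q-prime)
                           (Frobenius.period[2q+2] r q-prime)
                           (square≡1⇒≡±1 q-prime 2^r-squared)
    where
      open Frobenius r q-prime using (2^q)
      open import Relation.Binary.Reasoning.Setoid (mod-setoid {q})
      2^[2r] : 2 ℕ.^ (2 ℕ.* r) ≡ 2 ℕ.^ r ℕ.* 2 ℕ.^ r
      2^[2r] = trans (cong (λ i → 2 ℕ.^ (r ℕ.+ i)) (ℕ.+-identityʳ r)) (ℕ.^-distribˡ-+-* 2 r r)
      2^r-squared : + (2 ℕ.^ r) * + (2 ℕ.^ r) ≡ 1ℤ mod q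
      2^r-squared = mod-cancelˡ 2 q-prime (prime≢2⇒∤2 q-prime q≢2) (begin
        + 2 * (+ (2 ℕ.^ r) * + (2 ℕ.^ r)) ≡⟨ cong (+ 2 *_) (ℤ.pos-* (2 ℕ.^ r) (2 ℕ.^ r)) ⟨
        + 2 * + (2 ℕ.^ r ℕ.* 2 ℕ.^ r)     ≡⟨ ℤ.pos-* 2 (2 ℕ.^ r ℕ.* 2 ℕ.^ r) ⟨
        + (2 ℕ.* (2 ℕ.^ r ℕ.* 2 ℕ.^ r))   ≡⟨ cong (λ x → + (2 ℕ.* x)) 2^[2r] ⟨
        + (2 ℕ.^ q)                       ≈⟨ 2^q ⟩
        + 2 * 1ℤ                          ∎)

module PowersOfTwo where

  open Congruence
  open PellNumbers
  open Periods
  open Primes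
  import Data.Nat as ℕ
  open import Data.Nat using (zero; suc; _+_; _*_)
  import Data.Nat.Properties as ℕ
  open import Data.Nat.Divisibility
    using (_∣_; divides; 1∣_; ∣1⇒≡1; ∣m+n∣m⇒∣n; m∣m*n; *-cancelˡ-∣; ∣⇒≤)
  open import Data.Nat.Primality using (prime[2])
  open import Data.Nat.Tactic.RingSolver using (solve-∀)
  open import Data.Integer using (1ℤ)
  import Data.Integer.Divisibility.Signed as ℤ
  open import Data.Integer.Divisibility.Signed using (∣⇒∣ᵤ)
  open import Data.Sum using (inj₁; inj₂)
  open import Data.Empty using (⊥-elim)
  open import Relation.Nullary using (¬_)

  period[2] : Period 2 2
  period[2] = period-intro (∣⇒≡0 ℤ.∣-refl) (divides-difference (ℤ.divides 1ℤ refl))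

  period[2^[1+k]] : ∀ k → Period (2 ^ suc k) (2 ^ suc k)
  period[2^[1+k]] zero = period[2]
  period[2^[1+k]] (suc k) = period-lift (period[2^[1+k]] k) (divides (2 ^ k) (ℕ.*-comm 2 (2 ^ k)))

  Q-odd : ∀ n → ¬ 2 ∣ Q n
  Q-odd zero 2∣1 with () ← ∣1⇒≡1 2∣1
  Q-odd (suc n) 2∣Q[n]+2P[n] =
    Q-odd n (∣m+n∣m⇒∣n (subst (2 ∣_) (ℕ.+-comm (Q n) (2 * P n)) 2∣Q[n]+2P[n]) (m∣m*n (P n)))

  P-double : ∀ n → P (2 * n) ≡ 2 * (P n * Q n)
  P-double n = begin
    P (2 * n)           ≡⟨ cong (λ i → P (n + i)) (ℕ.+-identityʳ n) ⟩
    P (n + n)           ≡⟨ P-+ n n ⟩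
    Q n * P n + P n * Q n ≡⟨ regroup (P n) (Q n) ⟩
    2 * (P n * Q n)     ∎
    where open ≡-Reasoning
          regroup : ∀ p q → q * p + p * q ≡ 2 * (p * q)
          regroup = solve-∀

  2^[1+j]∤P[2^j] : ∀ j → ¬ 2 ^ suc j ∣ P (2 ^ j)
  2^[1+j]∤P[2^j] zero 2∣1 with () ← ∣1⇒≡1 2∣1
  2^[1+j]∤P[2^j] (suc j) 2^[2+j]∣P =
    2^[1+j]∤P[2^j] j (prime^∣-cancelʳ (suc j) prime[2] (Q-odd (2 ^ j))
      (*-cancelˡ-∣ 2 (subst (2 ^ suc (suc j) ∣_) (P-double (2 ^ j)) 2^[2+j]∣P)))

  period-2^k-∣ : ∀ k {T} → Period (2 ^ k) T → 2 ^ k ∣ T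
  period-2^k-∣ zero {T} _ = 1∣ T
  period-2^k-∣ (suc k) {T} period with period-2^k-∣ k (period-∣ (divides 2 refl) period)
  ... | divides c T≡c2^k with even⊎odd c
  ...   | t , inj₁ refl = divides t (trans T≡c2^k (regroup t (2 ^ k)))
    where regroup : ∀ t x → 2 * t * x ≡ t * (2 * x)
          regroup = solve-∀
  ...   | t , inj₂ refl = ⊥-elim (2^[1+j]∤P[2^j] k (∣⇒∣ᵤ (≡0⇒∣ (period⇒P≡0 half-period))))
    where
      T≡ : T ≡ 2 ^ k + t * 2 ^ suc k
      T≡ = trans T≡c2^k (regroup t (2 ^ k))
        where regroup : ∀ t x → suc (2 * t) * x ≡ x + t * (2 * x)
              regroup = solve-∀
      half-period : Period (2 ^ suc k) (2 ^ k)
      half-period = period-cancelʳ (subst (Period (2 ^ suc k)) T≡ period) (period-* (period[2^[1+k]] k) t)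

  power-of-2⇒shortest : ∀ {m} .{{_ : NonZero m}} → ∃[ k ] (1 ≤ k × m ≡ 2 ^ k) → IsShortestPeriodMod m m
  power-of-2⇒shortest (suc k , _ , refl) =
    period⇒isPeriod (ℕ.m^n>0 2 (suc k)) (period[2^[1+k]] k) ,
    λ T T-period → ∣⇒≤ {{ℕ.>-nonZero (proj₁ T-period)}} (period-2^k-∣ (suc k) (isPeriod⇒period T-period))

module LargestOddPrimeFactor where

  open Congruence
  open Periods
  open Primes
  open PrimePeriods
  open PowersOfTwo using (period[2])
  import Data.Nat as ℕ
  open import Data.Nat using (zero; suc; _+_; _*_; z≤n; s≤s; nonTrivial⇒n>1)
  import Data.Nat.Properties as ℕ
  open import Data.Nat.Divisibility
    using (_∣_; _∣?_; ∣1⇒≡1; ∣-trans; n∣m*n; *-monoʳ-∣; *-cancelˡ-∣; ∣⇒≤)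
  open import Data.Nat.Primality
    using (Prime; prime[2]; prime⇒irreducible; prime⇒nonZero; prime⇒nonTrivial; ¬prime[1]; euclidsLemma)
  open import Data.Nat.Primality.Factorisation using (factorise)
  open import Data.Nat.ListAction using (product)
  open import Data.Nat.ListAction.Properties using (∈⇒∣product)
  open import Data.List using ([]; _∷_; length)
  open import Data.List.Relation.Unary.All using (All; []; _∷_)
  open import Data.List.Extrema.Nat using (max; argmax-all; argmax-sel; xs≤max)
  open import Data.Sum using (inj₁; inj₂; [_,_]′)
  open import Data.Empty using (⊥; ⊥-elim)
  open import Function using (id)
  open import Relation.Nullary using (¬_; yes; no)
  open import Relation.Binary.PropositionalEquality using (_≢_)

  -- if p ∣ T then the p-adic valuation of T is smaller than that of r
  LowerValuation : ℕ → ℕ → ℕ → Set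
  LowerValuation p T r = ∀ j → p ^ suc j ∣ T → p ^ suc (suc j) ∣ r

  lowerValuation-1 : ∀ {p} → Prime p → LowerValuation p 1 1
  lowerValuation-1 {p} p-prime j p^[1+j]∣1 =
    ⊥-elim (¬prime[1] (subst Prime (ℕ.m*n≡1⇒m≡1 p (p ^ j) (∣1⇒≡1 p^[1+j]∣1)) p-prime))

  lowerValuation-coprime : ∀ {p U T s r} → Prime p → ¬ p ∣ U → s ∣ r →
                           LowerValuation p T s → LowerValuation p (U * T) r
  lowerValuation-coprime {p} {U} {T} p-prime p∤U s∣r lower j p^[1+j]∣UT =
    ∣-trans (lower j (prime^∣-cancelʳ (suc j) p-prime p∤U (subst (p ^ suc j ∣_) (ℕ.*-comm U T) p^[1+j]∣UT)))
            s∣r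

  lowerValuation-lift : ∀ {p q T s} → Prime p → Prime q → q ∣ s →
                        LowerValuation p T s → LowerValuation p (q * T) (q * s)
  lowerValuation-lift {p} {q} {T} {s} p-prime q-prime q∣s lower with q ℕ.≟ p
  ... | no q≢p = lowerValuation-coprime p-prime p∤q (n∣m*n q) lower
    where
      p∤q : ¬ p ∣ q
      p∤q p∣q with prime⇒irreducible q-prime p∣q
      ... | inj₁ refl = ¬prime[1] p-prime
      ... | inj₂ p≡q = q≢p (sym p≡q)
  ... | yes refl = λ j p^[1+j]∣pT → *-monoʳ-∣ p (p^[1+j]∣s j (*-cancelˡ-∣ p p^[1+j]∣pT))
    where
      instance _ = prime⇒nonZero p-prime
      p^[1+j]∣s : ∀ j → p ^ j ∣ T → p ^ suc j ∣ s
      p^[1+j]∣s zero _ = subst (_∣ s) (sym (ℕ.*-identityʳ p)) q∣s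
      p^[1+j]∣s (suc j) p^[1+j]∣T = lower j p^[1+j]∣T

  n<2^n : ∀ n → n < 2 ^ n
  n<2^n zero = s≤s z≤n
  n<2^n (suc n) = subst (suc (suc n) ≤_) (cong (2 ^ n +_) (sym (ℕ.+-identityʳ (2 ^ n))))
                        (ℕ.+-mono-≤ (ℕ.m^n>0 2 n) (n<2^n n))

  lowerValuation-∣⇒⊥ : ∀ {p T m} → Prime p → 0 < m → p ∣ m → m ∣ T → LowerValuation p T m → ⊥
  lowerValuation-∣⇒⊥ {p} {T} {m} p-prime m>0 p∣m m∣T lower =
    ℕ.<⇒≱ (ℕ.<-≤-trans (n<2^n m) 2^m≤p^[1+m]) (∣⇒≤ {{ℕ.>-nonZero m>0}} (p^[1+j]∣m m))
    where
      p^[1+j]∣m : ∀ j → p ^ suc j ∣ m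
      p^[1+j]∣m zero = subst (_∣ m) (sym (ℕ.*-identityʳ p)) p∣m
      p^[1+j]∣m (suc j) = lower j (∣-trans (p^[1+j]∣m j) m∣T)
      2^m≤p^[1+m] : 2 ^ m ≤ p ^ suc m
      2^m≤p^[1+m] = ℕ.≤-trans (ℕ.^-monoˡ-≤ m (nonTrivial⇒n>1 p {{prime⇒nonTrivial p-prime}}))
                              (ℕ.m≤n*m (p ^ m) p {{prime⇒nonZero p-prime}})

  prime-period-∤ : ∀ {p q} → Prime p → p ≢ 2 → Prime q → q ≤ p →
                   ∃[ T ] (0 < T × Period q T × ¬ p ∣ T)
  prime-period-∤ {p} {q} p-prime p≢2 q-prime q≤p with q ℕ.≟ 2
  ... | yes refl = 2 , s≤s z≤n , period[2] , prime≢2⇒∤2 p-prime p≢2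
  ... | no q≢2 with prime≢2⇒odd q-prime q≢2
  ...   | zero , refl = ⊥-elim (¬prime[1] q-prime)
  ...   | r@(suc _) , refl = [ (λ period → 2 * r , 2r>0 , period , p∤2r)
                                 , (λ period → 2 * suc q , s≤s z≤n , period , p∤2[q+1]) ]′
                                 (oddPrime-period q-prime q≢2)
    where
      2r>0 : 0 < 2 * r
      2r>0 = ℕ.*-monoʳ-< 2 (s≤s z≤n)
      p∤2r : ¬ p ∣ 2 * r
      p∤2r p∣2r = ℕ.<⇒≱ (ℕ.<-≤-trans (ℕ.n<1+n (2 * r)) q≤p) (∣⇒≤ {{ℕ.>-nonZero 2r>0}} p∣2r)
      r<q : suc r ≤ 2 * r
      r<q = subst (r <_) (ℕ.*-comm r 2) (ℕ.m<m*n r 2 (s≤s (s≤s z≤n)))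
      p∤2[q+1] : ¬ p ∣ 2 * suc q
      p∤2[q+1] p∣2[q+1] with euclidsLemma 2 (suc q) p-prime p∣2[q+1]
      ... | inj₁ p∣2 = prime≢2⇒∤2 p-prime p≢2 p∣2
      ... | inj₂ p∣q+1 with euclidsLemma 2 (suc r) p-prime (subst (p ∣_) (sym (ℕ.*-suc 2 r)) p∣q+1)
      ...   | inj₁ p∣2 = prime≢2⇒∤2 p-prime p≢2 p∣2
      ...   | inj₂ p∣r+1 = ℕ.<⇒≱ (ℕ.<-≤-trans (s≤s r<q) q≤p) (∣⇒≤ p∣r+1)

  smooth-period : ∀ {p} → Prime p → p ≢ 2 → ∀ {qs} → All Prime qs → All (_≤ p) qs →
                  ∃[ T ] (0 < T × Period (product qs) T × LowerValuation p T (product qs))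
  smooth-period p-prime p≢2 [] [] = 1 , s≤s z≤n , (λ _ → mod-1) , lowerValuation-1 p-prime
  smooth-period {p} p-prime p≢2 {q ∷ qs} (q-prime ∷ qs-prime) (q≤p ∷ qs≤p)
    with smooth-period p-prime p≢2 qs-prime qs≤p
  ... | T , T>0 , period , lower with q ∣? product qs
  ...   | yes q∣s =
    q * T , ℕ.*-mono-< (ℕ.>-nonZero⁻¹ q {{prime⇒nonZero q-prime}}) T>0 ,
    period-lift period q∣s ,
    lowerValuation-lift p-prime q-prime q∣s lower
  ...   | no q∤s with prime-period-∤ p-prime p≢2 q-prime q≤p
  ...     | U , U>0 , period[q] , p∤U =
    U * T , ℕ.*-mono-< U>0 T>0 ,
    period-coprime-* (prime∤⇒coprime q-prime q∤s)
      (subst (Period q) (ℕ.*-comm T U) (period-* period[q] T)) (period-* period U) ,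
    lowerValuation-coprime p-prime p∤U (n∣m*n q) lower

  odd-largest-prime-factor⇒¬shortest : ∀ {m p qs} .{{_ : NonZero m}} → m ≡ product qs → All Prime qs →
                                        Prime p → p ≢ 2 → p ∣ m → All (_≤ p) qs → ¬ IsShortestPeriodMod m m
  odd-largest-prime-factor⇒¬shortest {m} {p} m≡Πqs qs-prime p-prime p≢2 p∣m qs≤p shortest
    with smooth-period p-prime p≢2 qs-prime qs≤p
  ... | T , _ , period , lower = lowerValuation-∣⇒⊥ p-prime (ℕ.>-nonZero⁻¹ m) p∣m
    (shortest-period-∣ shortest (subst (λ r → Period r T) (sym m≡Πqs) period))
    (subst (LowerValuation p T) (sym m≡Πqs) lower)

  primes≤2⇒power-of-2 : ∀ {qs} → All Prime qs → All (_≤ 2) qs → product qs ≡ 2 ^ length qs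
  primes≤2⇒power-of-2 [] [] = refl
  primes≤2⇒power-of-2 {q ∷ _} (q-prime ∷ qs-prime) (q≤2 ∷ qs≤2) =
    cong₂ _*_ (ℕ.≤-antisym q≤2 (nonTrivial⇒n>1 q {{prime⇒nonTrivial q-prime}}))
              (primes≤2⇒power-of-2 qs-prime qs≤2)

  shortest⇒power-of-2 : ∀ {m} .{{_ : NonZero m}} → 1 < m → IsShortestPeriodMod m m →
                        ∃[ k ] (1 ≤ k × m ≡ 2 ^ k)
  shortest⇒power-of-2 {m} 1<m shortest with factorise m
  ... | record { factors = qs ; isFactorisation = m≡Πqs ; factorsPrime = qs-prime } with max 2 qs ℕ.≟ 2
  ...   | no p≢2 =
    ⊥-elim (odd-largest-prime-factor⇒¬shortest m≡Πqs qs-prime p-prime p≢2 p∣m (xs≤max 2 qs) shortest)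
    where
      p : ℕ
      p = max 2 qs
      p-prime : Prime p
      p-prime = argmax-all id prime[2] qs-prime
      p∣m : p ∣ m
      p∣m = subst (p ∣_) (sym m≡Πqs) ([ (λ p≡2 → ⊥-elim (p≢2 p≡2)) , ∈⇒∣product ]′ (argmax-sel id 2 qs))
  ...   | yes p≡2 = length qs , 1≤k , m≡2^k
    where
      m≡2^k : m ≡ 2 ^ length qs
      m≡2^k = trans m≡Πqs (primes≤2⇒power-of-2 qs-prime (subst (λ p → All (_≤ p) qs) p≡2 (xs≤max 2 qs)))
      1≤k : 1 ≤ length qs
      1≤k = ℕ.n≢0⇒n>0 (λ k≡0 → ℕ.<⇒≢ 1<m (sym (trans m≡2^k (cong (2 ^_) k≡0))))

corollary6p2 : (m : ℕ) .{{_ : NonZero m}} → 1 < m → IsShortestPeriodMod m m ⇔ (∃[ k ] (1 ≤ k × m ≡ 2 ^ k))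
corollary6p2 m 1<m = mk⇔ (LargestOddPrimeFactor.shortest⇒power-of-2 1<m) PowersOfTwo.power-of-2⇒shortest
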